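{- For every integer $n\geq 1$, the number of Fishburn permutations of length $n$ that avoid both classical patterns $321$ and $41523$ equals $\frac{P_n+P_{n-1}+1}{2}$, where $P_n$ denotes the Pell numbers, defined by $P_0=0$, $P_1=1$ and $P_n=2P_{n-1}+P_{n-2}$ for $n\geq 2$.
   Context: A permutation of length $n$ is a rearrangement $\pi=\pi_1\cdots\pi_n$ of $[n]$. A permutation $\pi$ contains a classical pattern $p\in S_k$ if some subsequence of $\pi$ of length $k$ is order-isomorphic to $p$; otherwise it avoids $p$. A Fishburn permutation is a permutation $\pi$ for which there are no indices $i<j$ with $\pi_j<\pi_i<\pi_{i+1}$ and $\pi_i=\pi_j+1$. -}

module Defs where

open import Data.Nat using (ℕ; zero; suc; _+_; _*_)
open import Data.Fin using (Fin; toℕ; inject₁) renaming (_<_ to _<ᶠ_)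
open import Data.Fin.Properties using (any?; all?; _≟_; _<?_)
open import Data.Vec using (Vec; lookup)
open import Data.Bool using (Bool; _∧_; not)
open import Data.Product using (∃; _×_; _,_)
open import Relation.Binary.PropositionalEquality using (_≡_)
open import Relation.Nullary using (Dec; yes; no; ¬_; does)
open import Relation.Nullary.Decidable using (_×-dec_; _→-dec_; ¬?)
import Data.Nat.Properties as ℕP

Pell : ℕ → ℕ
Pell zero = zero
Pell (suc zero) = suc zero
Pell (suc (suc n)) = 2 * Pell (suc n) + Pell n

-- A word of length n over [n] (0-based: value v stands for v+1, index i for position i+1).
-- π i is the (i+1)-th entry.
Word : ℕ → Set
Word n = Vec (Fin n) n

-- π is a permutation of [n]: injective (hence bijective since finite, domain = codomain).
IsPerm : ∀ {n} → Word n → Set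
IsPerm {n} π = ∀ (i j : Fin n) → lookup π i ≡ lookup π j → i ≡ j

Contains321 : ∀ {n} → Word n → Set
Contains321 {n} π = ∃ λ (i : Fin n) → ∃ λ (j : Fin n) → ∃ λ (k : Fin n) →
  (i <ᶠ j) × (j <ᶠ k) × (lookup π j <ᶠ lookup π i) × (lookup π k <ᶠ lookup π j)

Contains41523 : ∀ {n} → Word n → Set
Contains41523 {n} π = ∃ λ (a : Fin n) → ∃ λ (b : Fin n) → ∃ λ (c : Fin n) →
  ∃ λ (d : Fin n) → ∃ λ (e : Fin n) →
  (a <ᶠ b) × (b <ᶠ c) × (c <ᶠ d) × (d <ᶠ e) ×
  (lookup π b <ᶠ lookup π d) × (lookup π d <ᶠ lookup π e) ×
  (lookup π e <ᶠ lookup π a) × (lookup π a <ᶠ lookup π c)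

-- Fishburn violation: indices i < j (so i+1 is a position) with
-- π_j < π_i < π_{i+1} and π_i = π_j + 1.
-- Positions are Fin (suc m) for n = suc m; i ranges over Fin m, embedded by inject₁,
-- and i+1 is suc i.
FishburnViolation : ∀ {n} → Word n → Set
FishburnViolation {zero} π = ∃ λ (i : Fin zero) → ∃ λ (j : Fin zero) → i ≡ j
FishburnViolation {suc m} π = ∃ λ (i : Fin m) → ∃ λ (j : Fin (suc m)) →
  (inject₁ i <ᶠ j) × (lookup π j <ᶠ lookup π (inject₁ i)) ×
  (lookup π (inject₁ i) <ᶠ lookup π (Fin.suc i)) ×
  (toℕ (lookup π (inject₁ i)) ≡ suc (toℕ (lookup π j)))

IsFishburn : ∀ {n} → Word n → Set
IsFishburn π = ¬ FishburnViolation π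

isPerm? : ∀ {n} (π : Word n) → Dec (IsPerm π)
isPerm? π = all? λ i → all? λ j → (lookup π i ≟ lookup π j) →-dec (i ≟ j)

contains321? : ∀ {n} (π : Word n) → Dec (Contains321 π)
contains321? π = any? λ i → any? λ j → any? λ k →
  (i <? j) ×-dec (j <? k) ×-dec (lookup π j <? lookup π i) ×-dec (lookup π k <? lookup π j)

contains41523? : ∀ {n} (π : Word n) → Dec (Contains41523 π)
contains41523? π = any? λ a → any? λ b → any? λ c → any? λ d → any? λ e →
  (a <? b) ×-dec (b <? c) ×-dec (c <? d) ×-dec (d <? e) ×-dec
  (lookup π b <? lookup π d) ×-dec (lookup π d <? lookup π e) ×-dec
  (lookup π e <? lookup π a) ×-dec (lookup π a <? lookup π c)

fishburnViolation? : ∀ {n} (π : Word n) → Dec (FishburnViolation π)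
fishburnViolation? {zero} π = any? λ i → any? λ j → i ≟ j
fishburnViolation? {suc m} π = any? λ i → any? λ j →
  (inject₁ i <? j) ×-dec (lookup π j <? lookup π (inject₁ i)) ×-dec
  (lookup π (inject₁ i) <? lookup π (Fin.suc i)) ×-dec
  (toℕ (lookup π (inject₁ i)) ℕP.≟ suc (toℕ (lookup π j)))

isCounted : ∀ {n} → Word n → Bool
isCounted π = does (isPerm? π) ∧ not (does (fishburnViolation? π))
              ∧ not (does (contains321? π)) ∧ not (does (contains41523? π))

-- Every counted permutation of length n+1 arises uniquely from one of length n by
-- appending a last letter v and raising the earlier letters ≥ v by one, and the result
-- is counted iff no Fishburn pair, 321 or 41523 would end at v. For σ of length m+1
-- the two largest letters always qualify; a smaller one qualifies iff σ ends with its
-- maximum and has a descent, and then only the top of the highest descent does. Deleting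
-- that final maximum matches these σ with the counted words of length m other than the
-- identity. So the counts satisfy a(m+2) = 2 a(m+1) + a(m) − 1 with a(0) = a(1) = 1,
-- the recurrence of (P(n) + P(n−1) + 1)/2.

module Submission where

open import Data.Bool using (Bool; T; not; _∧_)
open import Data.Bool.Properties using (T-irrelevant)
open import Data.Empty using (⊥; ⊥-elim)
open import Data.Fin using (Fin; toℕ; fromℕ; fromℕ<; inject₁; punchIn; punchOut)
  renaming (zero to fzero; suc to fsuc)
open import Data.Fin.Properties
  using (toℕ-injective; toℕ<n; toℕ-fromℕ; toℕ-fromℕ<; toℕ-inject₁; punchIn-punchOut; *↔×; +↔⊎)
import Data.Fin.Properties as FinP
open import Data.Nat
open import Data.Nat.Properties
open import Data.Nat.Tactic.RingSolver using (solve-∀)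
open import Data.Product using (Σ; ∃; _×_; _,_; proj₁; proj₂)
open import Data.Product.Function.Dependent.Propositional using (Σ-↔)
open import Data.Product.Function.NonDependent.Propositional using (_×-↔_)
open import Data.Sum using (_⊎_; inj₁; inj₂)
open import Data.Sum.Function.Propositional using (_⊎-↔_)
open import Data.Sum.Properties using (inj₁-injective)
open import Data.Unit using (⊤; tt)
open import Data.Vec using (Vec; []; _∷_; lookup; map; _∷ʳ_; tabulate; allFin)
open import Data.Vec.Properties using (lookup∘tabulate; lookup-allFin)
open import Function using (_∘_)
open import Function.Bundles using (_⇔_; mk⇔; Equivalence; _↔_; mk↔ₛ′; Inverse)
open import Function.Properties.Inverse using (↔-refl; ↔-sym; ↔-trans)
open import Function.Related.TypeIsomorphisms using (Σ-distribˡ-⊎)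
open import Relation.Binary.Definitions using (tri<; tri≈; tri>)
open import Relation.Binary.PropositionalEquality
open import Relation.Nullary using (¬_; Dec; yes; no; does)
open import Relation.Nullary.Decidable using (map′; _×-dec_)

open import Defs

punchInℕ : ℕ → ℕ → ℕ
punchInℕ zero    x       = suc x
punchInℕ (suc v) zero    = zero
punchInℕ (suc v) (suc x) = suc (punchInℕ v x)

punchInℕ-< : ∀ {v x} → x < v → punchInℕ v x ≡ x
punchInℕ-< {suc v} {zero}  _       = refl
punchInℕ-< {suc v} {suc x} (s≤s p) = cong suc (punchInℕ-< p)

punchInℕ-≥ : ∀ {v x} → v ≤ x → punchInℕ v x ≡ suc x
punchInℕ-≥ {zero}          _       = refl
punchInℕ-≥ {suc v} {suc x} (s≤s p) = cong suc (punchInℕ-≥ p)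

punchInℕ-mono-≤ : ∀ v {x y} → x ≤ y → punchInℕ v x ≤ punchInℕ v y
punchInℕ-mono-≤ zero    p                           = s≤s p
punchInℕ-mono-≤ (suc v) {zero}                  _   = z≤n
punchInℕ-mono-≤ (suc v) {suc x} {suc y} (s≤s p)     = s≤s (punchInℕ-mono-≤ v p)

punchInℕ-mono-< : ∀ v {x y} → x < y → punchInℕ v x < punchInℕ v y
punchInℕ-mono-< zero    p                       = s≤s p
punchInℕ-mono-< (suc v) {zero}  {suc y} _       = s≤s z≤n
punchInℕ-mono-< (suc v) {suc x} {suc y} (s≤s p) = s≤s (punchInℕ-mono-< v p)

punchInℕ-cancel-< : ∀ v {x y} → punchInℕ v x < punchInℕ v y → x < y
punchInℕ-cancel-< v {x} {y} lt with x <? y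
... | yes x<y = x<y
... | no  x≮y = ⊥-elim (<⇒≱ lt (punchInℕ-mono-≤ v (≮⇒≥ x≮y)))

punchInℕ-injective : ∀ v {x y} → punchInℕ v x ≡ punchInℕ v y → x ≡ y
punchInℕ-injective zero                    p = suc-injective p
punchInℕ-injective (suc v) {zero}  {zero}  p = refl
punchInℕ-injective (suc v) {suc x} {suc y} p = cong suc (punchInℕ-injective v (suc-injective p))

punchInℕ≢pivot : ∀ v {x} → punchInℕ v x ≢ v
punchInℕ≢pivot (suc v) {suc x} p = punchInℕ≢pivot v (suc-injective p)

punchInℕ≡1+pivot⁻¹ : ∀ v {x} → punchInℕ v x ≡ suc v → x ≡ v
punchInℕ≡1+pivot⁻¹ zero            p = suc-injective p
punchInℕ≡1+pivot⁻¹ (suc v) {suc x} p = cong suc (punchInℕ≡1+pivot⁻¹ v (suc-injective p))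

punchInℕ<pivot⁻¹ : ∀ v {x} → punchInℕ v x < v → x < v
punchInℕ<pivot⁻¹ (suc v) {zero}  _       = s≤s z≤n
punchInℕ<pivot⁻¹ (suc v) {suc x} (s≤s p) = s≤s (punchInℕ<pivot⁻¹ v p)

pivot<punchInℕ⁻¹ : ∀ v {x} → v < punchInℕ v x → v ≤ x
pivot<punchInℕ⁻¹ zero            _       = z≤n
pivot<punchInℕ⁻¹ (suc v) {suc x} (s≤s p) = s≤s (pivot<punchInℕ⁻¹ v p)

punchInℕ≤1+ : ∀ v x → punchInℕ v x ≤ suc x
punchInℕ≤1+ zero    x       = ≤-refl
punchInℕ≤1+ (suc v) zero    = z≤n
punchInℕ≤1+ (suc v) (suc x) = s≤s (punchInℕ≤1+ v x)

punchInℕ-suc : ∀ v {y} → suc y ≢ v → punchInℕ v (suc y) ≡ suc (punchInℕ v y)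
punchInℕ-suc zero                  _  = refl
punchInℕ-suc (suc zero)    {zero}  ne = ⊥-elim (ne refl)
punchInℕ-suc (suc (suc v)) {zero}  _  = refl
punchInℕ-suc (suc v)       {suc y} ne = cong suc (punchInℕ-suc v (ne ∘ cong suc))

punchInℕ-adjacent : ∀ v {x y} → punchInℕ v x ≡ suc (punchInℕ v y) → y < x → x ≡ suc y
punchInℕ-adjacent zero                    p _       = suc-injective p
punchInℕ-adjacent (suc v) {suc x} {zero}  p _       = cong suc (punchInℕ≡0⁻¹ v (suc-injective p))
  where
  punchInℕ≡0⁻¹ : ∀ v {x} → punchInℕ v x ≡ 0 → x ≡ 0
  punchInℕ≡0⁻¹ (suc v) {zero} _ = refl
punchInℕ-adjacent (suc v) {suc x} {suc y} p (s≤s q) = cong suc (punchInℕ-adjacent v (suc-injective p) q)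

punchInℕ<1+⁻¹ : ∀ {v x N} → v ≤ N → punchInℕ v x < suc N → x < N
punchInℕ<1+⁻¹ {v} {x} v≤N lt with x <? v
... | yes x<v = <-≤-trans x<v v≤N
... | no  x≮v = s≤s⁻¹ (subst (_< _) (punchInℕ-≥ (≮⇒≥ x≮v)) lt)

InjectiveBelow : (ℕ → ℕ) → ℕ → Set
InjectiveBelow s N = ∀ {i j} → i < N → j < N → s i ≡ s j → i ≡ j

MapsBelow : (ℕ → ℕ) → ℕ → Set
MapsBelow s N = ∀ {i} → i < N → s i < N

SurjectiveBelow : (ℕ → ℕ) → ℕ → Set
SurjectiveBelow s N = ∀ {x} → x < N → ∃ λ k → k < N × s k ≡ x

Has321 : (ℕ → ℕ) → ℕ → Set
Has321 s N = ∃ λ i → ∃ λ j → ∃ λ k →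
  i < j × j < k × k < N × s j < s i × s k < s j

Has41523 : (ℕ → ℕ) → ℕ → Set
Has41523 s N = ∃ λ a → ∃ λ b → ∃ λ c → ∃ λ d → ∃ λ e →
  a < b × b < c × c < d × d < e × e < N ×
  s b < s d × s d < s e × s e < s a × s a < s c

HasFishburnPair : (ℕ → ℕ) → ℕ → Set
HasFishburnPair s N = ∃ λ i → ∃ λ j →
  suc i < N × i < j × j < N × s j < s i × s i < s (suc i) × s i ≡ suc (s j)

record Admissible (s : ℕ → ℕ) (N : ℕ) : Set where
  field
    injective   : InjectiveBelow s N
    bounded     : MapsBelow s N
    fishburn    : ¬ HasFishburnPair s N
    avoids321   : ¬ Has321 s N
    avoids41523 : ¬ Has41523 s N

Descent : (ℕ → ℕ) → ℕ → Set
Descent s r = s (suc r) < s r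

HasDescent : (ℕ → ℕ) → ℕ → Set
HasDescent s N = ∃ λ r → suc r < N × Descent s r

hasDescent? : ∀ s N → Dec (HasDescent s N)
hasDescent? s N = map′ (λ (r , _ , h) → r , h) (λ (r , sr<N , d) → r , <-trans (n<1+n r) sr<N , sr<N , d)
  (anyUpTo? (λ r → (suc r <? N) ×-dec (s (suc r) <? s r)) N)

descent-between : ∀ s {i} j → i < j → s j < s i → ∃ λ q → q < j × Descent s q × s i ≤ s q
descent-between s {i} (suc j) (s≤s i≤j) lt with m≤n⇒m<n∨m≡n i≤j
... | inj₂ refl = i , n<1+n i , lt , ≤-refl
... | inj₁ i<j with s j <? s i
...   | yes ji = let (q , q<j , dq , le) = descent-between s j i<j ji in q , m<n⇒m<1+n q<j , dq , le
...   | no  ji = j , n<1+n j , <-≤-trans lt (≮⇒≥ ji) , ≮⇒≥ ji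

<-suc-cases : ∀ {P : ℕ → Set} {K} → (∀ {r} → r < K → P r) → P K → ∀ {r} → r < suc K → P r
<-suc-cases below atK r<sK with m<1+n⇒m<n∨m≡n r<sK
... | inj₁ r<K  = below r<K
... | inj₂ refl = atK

record MaximalDescent (s : ℕ → ℕ) (K : ℕ) : Set where
  field
    position   : ℕ
    position<K : position < K
    descent    : Descent s position
    maximal    : ∀ {r} → r < K → Descent s r → s r ≤ s position

newMaximalDescent : ∀ {s K} → Descent s K → (∀ {r} → r < K → Descent s r → s r ≤ s K) →
                    MaximalDescent s (suc K)
newMaximalDescent {K = K} dK below = record
  { position = K ; position<K = n<1+n K ; descent = dK ; maximal = <-suc-cases below (λ _ → ≤-refl) }

extendMaximalDescent : ∀ {s K} (m : MaximalDescent s K) →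
                       (Descent s K → s K ≤ s (MaximalDescent.position m)) → MaximalDescent s (suc K)
extendMaximalDescent m atK = record
  { position = position ; position<K = m<n⇒m<1+n position<K ; descent = descent
  ; maximal = <-suc-cases maximal atK }
  where open MaximalDescent m

maximalDescent? : ∀ s K → MaximalDescent s K ⊎ (∀ {r} → r < K → ¬ Descent s r)
maximalDescent? s zero = inj₂ λ ()
maximalDescent? s (suc K) with maximalDescent? s K | s (suc K) <? s K
... | inj₂ none | no ¬dK = inj₂ (<-suc-cases none ¬dK)
... | inj₂ none | yes dK = inj₁ (newMaximalDescent dK (λ r<K dr → ⊥-elim (none r<K dr)))
... | inj₁ m | no ¬dK = inj₁ (extendMaximalDescent m (λ dK → ⊥-elim (¬dK dK)))
... | inj₁ m | yes dK with s (MaximalDescent.position m) ≤? s K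
...   | yes le = inj₁ (newMaximalDescent dK (λ r<K dr → ≤-trans (MaximalDescent.maximal m r<K dr) le))
...   | no  gt = inj₁ (extendMaximalDescent m (λ _ → <⇒≤ (≰⇒> gt)))

increasing⇒identity : ∀ {s N} → MapsBelow s N → (∀ {r} → suc r < N → s r < s (suc r)) →
                      ∀ {k} → k < N → s k ≡ k
increasing⇒identity {s} {N} bnd asc {k} k<N =
  ≤-antisym (below _ (proj₂ (m≤n⇒∃[o]m+o≡n k<N))) (above k k<N)
  where
  above : ∀ k → k < N → k ≤ s k
  above zero    _    = z≤n
  above (suc k) sk<N = ≤-<-trans (above k (<-trans (n<1+n k) sk<N)) (asc sk<N)
  below : ∀ d {k} → suc k + d ≡ N → s k ≤ k
  below zero    {k} e = s≤s⁻¹ (subst (s k <_) (trans (sym e) (+-identityʳ (suc k)))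
                                  (bnd (subst (suc k ≤_) e (m≤m+n (suc k) 0))))
  below (suc d) {k} e = s≤s⁻¹ (<-≤-trans (asc sk<N) (below d e′))
    where
    e′ : suc (suc k) + d ≡ N
    e′ = trans (sym (+-suc (suc k) d)) e
    sk<N : suc k < N
    sk<N = subst (suc (suc k) ≤_) e′ (m≤m+n (suc (suc k)) d)

noDescent⇒identity : ∀ {s N} → InjectiveBelow s N → MapsBelow s N → ¬ HasDescent s N →
                     ∀ {k} → k < N → s k ≡ k
noDescent⇒identity {s} inj bnd noDescent = increasing⇒identity bnd ascent
  where
  ascent : ∀ {r} → suc r < _ → s r < s (suc r)
  ascent {r} sr<N = ≤∧≢⇒< (≮⇒≥ (λ d → noDescent (r , sr<N , d)))
                          (λ e → <-irrefl (inj (<-trans (n<1+n r) sr<N) sr<N e) (n<1+n r))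

identity-admissible : ∀ {s N} → (∀ {k} → k < N → s k ≡ k) → Admissible s N
identity-admissible {s} {N} fixed = record
  { injective   = λ p q e → trans (sym (fixed p)) (trans e (fixed q))
  ; bounded     = λ p → subst (_< N) (sym (fixed p)) p
  ; fishburn    = λ (i , j , _ , i<j , j<N , ji , _) → noInversion i<j j<N ji
  ; avoids321   = λ (i , j , k , i<j , j<k , k<N , ji , _) → noInversion i<j (<-trans j<k k<N) ji
  ; avoids41523 = λ (a , b , c , d , e , ab , bc , cd , de , e<N , _ , _ , ea , _) →
                    noInversion (<-trans ab (<-trans bc (<-trans cd de))) e<N ea }
  where
  noInversion : ∀ {i j} → i < j → j < N → ¬ s j < s i
  noInversion i<j j<N lt = <-asym i<j (subst₂ _<_ (fixed j<N) (fixed (<-trans i<j j<N)) lt)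

-- Appending a last letter

record Appends (s t : ℕ → ℕ) (N v : ℕ) : Set where
  field
    shifted : ∀ {k} → k < N → t k ≡ punchInℕ v (s k)
    last    : t N ≡ v
    v≤N     : v ≤ N

-- The occurrences of a Fishburn pair, 321 and 41523 in t that end with the
-- appended letter, read back in s.

NoAscentAfter : (ℕ → ℕ) → ℕ → ℕ → Set
NoAscentAfter s N v = ∀ {i} → suc i < N → s i ≡ v → ¬ s i < s (suc i)

NoInversionAbove : (ℕ → ℕ) → ℕ → ℕ → Set
NoInversionAbove s N v = ∀ {i j} → i < j → j < N → s j < s i → ¬ v ≤ s j

No4152Around : (ℕ → ℕ) → ℕ → ℕ → Set
No4152Around s N v = ∀ {a b c d} → a < b → b < c → c < d → d < N →
  s b < s d → s d < v → v ≤ s a → ¬ s a < s c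

record Appendable (s : ℕ → ℕ) (N v : ℕ) : Set where
  field
    noAscentAfter    : NoAscentAfter s N v
    noInversionAbove : NoInversionAbove s N v
    no4152Around     : No4152Around s N v

module _ {s t : ℕ → ℕ} {N v : ℕ} (E : Appends s t N v) where
  open Appends E

  appends-mono-< : ∀ {i j} → i < N → j < N → s i < s j → t i < t j
  appends-mono-< p q lt = subst₂ _<_ (sym (shifted p)) (sym (shifted q)) (punchInℕ-mono-< v lt)

  appends-cancel-< : ∀ {i j} → i < N → j < N → t i < t j → s i < s j
  appends-cancel-< p q lt = punchInℕ-cancel-< v (subst₂ _<_ (shifted p) (shifted q) lt)

  appends-below : ∀ {i} → i < N → s i < v → t i < t N
  appends-below p lt = subst₂ _<_ (sym (trans (shifted p) (punchInℕ-< lt))) (sym last) lt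

  appends-above : ∀ {i} → i < N → v ≤ s i → t N < t i
  appends-above p le = subst₂ _<_ (sym last) (sym (trans (shifted p) (punchInℕ-≥ le))) (s≤s le)

  appends-below⁻¹ : ∀ {i} → i < N → t i < t N → s i < v
  appends-below⁻¹ p lt = punchInℕ<pivot⁻¹ v (subst₂ _<_ (shifted p) last lt)

  appends-above⁻¹ : ∀ {i} → i < N → t N < t i → v ≤ s i
  appends-above⁻¹ p lt = pivot<punchInℕ⁻¹ v (subst₂ _<_ last (shifted p) lt)

  appends-pivot : ∀ {i} → i < N → s i ≡ v → t i ≡ suc (t N)
  appends-pivot {i} p e = begin
    t i                  ≡⟨ shifted p ⟩
    punchInℕ v (s i)     ≡⟨ cong (punchInℕ v) e ⟩
    punchInℕ v v         ≡⟨ punchInℕ-≥ ≤-refl ⟩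
    suc v                ≡⟨ cong suc (sym last) ⟩
    suc (t N)            ∎
    where open ≡-Reasoning

  injective-append⁻ : InjectiveBelow t (suc N) → InjectiveBelow s N
  injective-append⁻ inj p q e =
    inj (m<n⇒m<1+n p) (m<n⇒m<1+n q) (trans (shifted p) (trans (cong (punchInℕ v) e) (sym (shifted q))))

  injective-append⁺ : InjectiveBelow s N → InjectiveBelow t (suc N)
  injective-append⁺ inj p q e with m<1+n⇒m<n∨m≡n p | m<1+n⇒m<n∨m≡n q
  ... | inj₁ i<N | inj₁ j<N  =
    inj i<N j<N (punchInℕ-injective v (trans (sym (shifted i<N)) (trans e (shifted j<N))))
  ... | inj₁ i<N | inj₂ refl = ⊥-elim (punchInℕ≢pivot v (trans (sym (shifted i<N)) (trans e last)))
  ... | inj₂ refl | inj₁ j<N = ⊥-elim (punchInℕ≢pivot v (trans (sym (shifted j<N)) (trans (sym e) last)))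
  ... | inj₂ refl | inj₂ refl = refl

  bounded-append⁻ : MapsBelow t (suc N) → MapsBelow s N
  bounded-append⁻ bnd p = punchInℕ<1+⁻¹ v≤N (subst (_< suc N) (shifted p) (bnd (m<n⇒m<1+n p)))

  bounded-append⁺ : MapsBelow s N → MapsBelow t (suc N)
  bounded-append⁺ bnd p with m<1+n⇒m<n∨m≡n p
  ... | inj₁ i<N  = subst (_< suc N) (sym (shifted i<N)) (s≤s (≤-trans (punchInℕ≤1+ v _) (bnd i<N)))
  ... | inj₂ refl = subst (_< suc N) (sym last) (s≤s v≤N)

  fishburn-append⁻ : ¬ HasFishburnPair t (suc N) → ¬ HasFishburnPair s N × NoAscentAfter s N v
  fishburn-append⁻ noPair = noPair ∘ lift , λ si<N e lt → noPair (ascent⇒pair si<N e lt)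
    where
    ascent⇒pair : ∀ {i} → suc i < N → s i ≡ v → s i < s (suc i) → HasFishburnPair t (suc N)
    ascent⇒pair {i} si<N e lt =
      i , N , m<n⇒m<1+n si<N , i<N , n<1+n N ,
      subst (t N <_) (sym (appends-pivot i<N e)) (n<1+n (t N)) ,
      appends-mono-< i<N si<N lt , appends-pivot i<N e
      where i<N = <-trans (n<1+n i) si<N
    lift : HasFishburnPair s N → HasFishburnPair t (suc N)
    lift (i , j , si<N , i<j , j<N , sj<si , si<ssi , eq) with s i ≟ v
    ... | yes e = ascent⇒pair si<N e si<ssi
    ... | no ne =
      i , j , m<n⇒m<1+n si<N , i<j , m<n⇒m<1+n j<N ,
      appends-mono-< j<N i<N sj<si , appends-mono-< i<N si<N si<ssi ,
      (begin
        t i                        ≡⟨ shifted i<N ⟩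
        punchInℕ v (s i)           ≡⟨ cong (punchInℕ v) eq ⟩
        punchInℕ v (suc (s j))     ≡⟨ punchInℕ-suc v (λ e → ne (trans eq e)) ⟩
        suc (punchInℕ v (s j))     ≡⟨ cong suc (sym (shifted j<N)) ⟩
        suc (t j)                  ∎)
      where
      open ≡-Reasoning
      i<N = <-trans i<j j<N

  fishburn-append⁺ : ¬ HasFishburnPair s N → NoAscentAfter s N v → ¬ HasFishburnPair t (suc N)
  fishburn-append⁺ noPair noAscent (i , j , si<sN , i<j , j<sN , tj<ti , ti<tsi , eq)
    with m<1+n⇒m<n∨m≡n j<sN | m<1+n⇒m<n∨m≡n si<sN
  ... | inj₂ refl | inj₂ refl = <-asym tj<ti ti<tsi
  ... | inj₂ refl | inj₁ si<N =
    noAscent si<N (punchInℕ≡1+pivot⁻¹ v (trans (sym (shifted i<N)) (trans eq (cong suc last))))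
      (appends-cancel-< i<N si<N ti<tsi)
    where i<N = <-trans (n<1+n i) si<N
  ... | inj₁ j<N | _ =
    noPair (i , j , si<N , i<j , j<N , sj<si , appends-cancel-< i<N si<N ti<tsi ,
            punchInℕ-adjacent v (trans (sym (shifted i<N)) (trans eq (cong suc (shifted j<N)))) sj<si)
    where
    i<N = <-trans i<j j<N
    si<N = ≤-<-trans i<j j<N
    sj<si = appends-cancel-< j<N i<N tj<ti

  avoids321-append⁻ : ¬ Has321 t (suc N) → ¬ Has321 s N × NoInversionAbove s N v
  avoids321-append⁻ no321 = no321 ∘ lift , inversion⇒321
    where
    lift : Has321 s N → Has321 t (suc N)
    lift (i , j , k , i<j , j<k , k<N , ji , kj) =
      i , j , k , i<j , j<k , m<n⇒m<1+n k<N , appends-mono-< j<N i<N ji , appends-mono-< k<N j<N kj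
      where
      j<N = <-trans j<k k<N
      i<N = <-trans i<j j<N
    inversion⇒321 : NoInversionAbove s N v
    inversion⇒321 {i} {j} i<j j<N ji v≤sj =
      no321 (i , j , N , i<j , j<N , n<1+n N , appends-mono-< j<N (<-trans i<j j<N) ji , appends-above j<N v≤sj)

  avoids321-append⁺ : ¬ Has321 s N → NoInversionAbove s N v → ¬ Has321 t (suc N)
  avoids321-append⁺ no321 noInversion (i , j , k , i<j , j<k , k<sN , ji , kj) with m<1+n⇒m<n∨m≡n k<sN
  ... | inj₁ k<N = no321 (i , j , k , i<j , j<k , k<N , appends-cancel-< j<N i<N ji , appends-cancel-< k<N j<N kj)
    where
    j<N = <-trans j<k k<N
    i<N = <-trans i<j j<N
  ... | inj₂ refl = noInversion i<j j<k (appends-cancel-< j<k (<-trans i<j j<k) ji) (appends-above⁻¹ j<k kj)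

  avoids41523-append⁻ : ¬ Has41523 t (suc N) → ¬ Has41523 s N × No4152Around s N v
  avoids41523-append⁻ no41523 = no41523 ∘ lift , 4152⇒41523
    where
    lift : Has41523 s N → Has41523 t (suc N)
    lift (a , b , c , d , e , ab , bc , cd , de , e<N , bd , de′ , ea , ac) =
      a , b , c , d , e , ab , bc , cd , de , m<n⇒m<1+n e<N ,
      appends-mono-< b<N d<N bd , appends-mono-< d<N e<N de′ ,
      appends-mono-< e<N a<N ea , appends-mono-< a<N c<N ac
      where
      d<N = <-trans de e<N
      c<N = <-trans cd d<N
      b<N = <-trans bc c<N
      a<N = <-trans ab b<N
    4152⇒41523 : No4152Around s N v
    4152⇒41523 {a} {b} {c} {d} ab bc cd d<N bd dv va ac =
      no41523 (a , b , c , d , N , ab , bc , cd , d<N , n<1+n N ,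
               appends-mono-< b<N d<N bd , appends-below d<N dv ,
               appends-above a<N va , appends-mono-< a<N c<N ac)
      where
      c<N = <-trans cd d<N
      b<N = <-trans bc c<N
      a<N = <-trans ab b<N

  avoids41523-append⁺ : ¬ Has41523 s N → No4152Around s N v → ¬ Has41523 t (suc N)
  avoids41523-append⁺ no41523 no4152 (a , b , c , d , e , ab , bc , cd , de , e<sN , bd , de′ , ea , ac)
    with m<1+n⇒m<n∨m≡n e<sN
  ... | inj₁ e<N =
    no41523 (a , b , c , d , e , ab , bc , cd , de , e<N ,
             appends-cancel-< b<N d<N bd , appends-cancel-< d<N e<N de′ ,
             appends-cancel-< e<N a<N ea , appends-cancel-< a<N c<N ac)
    where
    d<N = <-trans de e<N
    c<N = <-trans cd d<N
    b<N = <-trans bc c<N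
    a<N = <-trans ab b<N
  ... | inj₂ refl =
    no4152 ab bc cd de (appends-cancel-< b<N de bd) (appends-below⁻¹ de de′)
           (appends-above⁻¹ a<N ea) (appends-cancel-< a<N c<N ac)
    where
    c<N = <-trans cd de
    b<N = <-trans bc c<N
    a<N = <-trans ab b<N

  appends-descent⁺ : ∀ {r} → suc r < N → Descent s r → Descent t r
  appends-descent⁺ sr<N = appends-mono-< sr<N (<-trans (n<1+n _) sr<N)

  appends-descent⁻ : ∀ {r} → suc r < N → Descent t r → Descent s r
  appends-descent⁻ sr<N = appends-cancel-< sr<N (<-trans (n<1+n _) sr<N)

  hasDescent-append⁺ : HasDescent s N → HasDescent t (suc N)
  hasDescent-append⁺ (r , sr<N , d) = r , m<n⇒m<1+n sr<N , appends-descent⁺ sr<N d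

  hasDescent-append⁻ : MapsBelow s N → N ≤ v → HasDescent t (suc N) → HasDescent s N
  hasDescent-append⁻ bnd N≤v (r , sr<sN , d) with m<1+n⇒m<n∨m≡n sr<sN
  ... | inj₁ sr<N = r , sr<N , appends-descent⁻ sr<N d
  ... | inj₂ refl = ⊥-elim (<⇒≱ (bnd (n<1+n r)) (≤-trans N≤v (appends-above⁻¹ (n<1+n r) d)))

  admissible-append⁻ : Admissible t (suc N) → Admissible s N × Appendable s N v
  admissible-append⁻ G =
    record { injective   = injective-append⁻ G.injective
           ; bounded     = bounded-append⁻ G.bounded
           ; fishburn    = proj₁ (fishburn-append⁻ G.fishburn)
           ; avoids321   = proj₁ (avoids321-append⁻ G.avoids321)
           ; avoids41523 = proj₁ (avoids41523-append⁻ G.avoids41523) } ,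
    record { noAscentAfter    = proj₂ (fishburn-append⁻ G.fishburn)
           ; noInversionAbove = proj₂ (avoids321-append⁻ G.avoids321)
           ; no4152Around     = proj₂ (avoids41523-append⁻ G.avoids41523) }
    where module G = Admissible G

  admissible-append⁺ : Admissible s N → Appendable s N v → Admissible t (suc N)
  admissible-append⁺ G V =
    record { injective   = injective-append⁺ G.injective
           ; bounded     = bounded-append⁺ G.bounded
           ; fishburn    = fishburn-append⁺ G.fishburn V.noAscentAfter
           ; avoids321   = avoids321-append⁺ G.avoids321 V.noInversionAbove
           ; avoids41523 = avoids41523-append⁺ G.avoids41523 V.no4152Around }
    where
    module G = Admissible G
    module V = Appendable V

-- The letters that can be appended

appendable-max : ∀ {s N} → MapsBelow s N → Appendable s N N
appendable-max bnd = record
  { noAscentAfter    = λ si<N e _ → <-irrefl e (bnd (<-trans (n<1+n _) si<N))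
  ; noInversionAbove = λ _ j<N _ → <⇒≱ (bnd j<N)
  ; no4152Around     = λ ab bc cd d<N _ _ va _ → <⇒≱ (bnd (<-trans ab (<-trans bc (<-trans cd d<N)))) va }

appendable-pred-max : ∀ {s M} → MapsBelow s (suc M) → Appendable s (suc M) M
appendable-pred-max {s} bnd = record
  { noAscentAfter    = λ {i} si<N e lt → <⇒≱ (bnd si<N) (subst (λ x → suc x ≤ s (suc i)) e lt)
  ; noInversionAbove = λ i<j j<N ji le → <⇒≱ (bnd (<-trans i<j j<N)) (≤-trans (s≤s le) ji)
  ; no4152Around     = λ ab bc cd d<N _ _ va ac → <⇒≱ (bnd (<-trans cd d<N)) (≤-trans (s≤s va) ac) }

larger-after : ∀ {s N v p q} → NoInversionAbove s N v → p < N → s p ≡ v → v < s q → p < q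
larger-after {s} {v = v} {p} {q} noInversion p<N sp≡v v<sq with <-cmp p q
... | tri< p<q _ _  = p<q
... | tri≈ _ refl _ = ⊥-elim (<-irrefl refl (subst (v <_) sp≡v v<sq))
... | tri> _ _ q<p  = ⊥-elim (noInversion q<p p<N (subst (_< s q) (sym sp≡v) v<sq) (≤-reflexive (sym sp≡v)))

inversion-below : ∀ {s N v i j} → NoInversionAbove s N v → i < j → j < N → s j < s i → s j < v
inversion-below noInversion i<j j<N ji = ≰⇒> (noInversion i<j j<N ji)

-- An inversion above the top of the highest descent would contain a higher descent.
maximalDescent-appendable : ∀ {s K} → InjectiveBelow s (suc K) → (m : MaximalDescent s K) →
                            Appendable s (suc K) (s (MaximalDescent.position m))
maximalDescent-appendable {s} inj m = record
  { noAscentAfter    = noAscentAfter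
  ; noInversionAbove = λ {i} {j} i<j j<N ji le →
      let (q , q<j , dq , si≤sq) = descent-between s j i<j ji in
      <⇒≱ (≤-<-trans le ji) (≤-trans si≤sq (maximal (<-≤-trans q<j (s≤s⁻¹ j<N)) dq))
  ; no4152Around     = λ {a} {b} {c} {d} ab bc cd d<N bd dv va ac →
      let (q , q<d , dq , sc≤sq) = descent-between s d cd (<-trans dv (≤-<-trans va ac)) in
      <⇒≱ (≤-<-trans va ac) (≤-trans sc≤sq (maximal (<-≤-trans q<d (s≤s⁻¹ d<N)) dq)) }
  where
  open MaximalDescent m
  noAscentAfter : NoAscentAfter s (suc _) (s position)
  noAscentAfter {i} si<N e lt with inj (<-trans (n<1+n i) si<N) (m<n⇒m<1+n position<K) e
  ... | refl = <-asym descent lt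

module _ {s : ℕ → ℕ} {M : ℕ} (G : Admissible s (suc M)) where
  open Admissible G

  -- Either p, p+1, q, q+1 and the appended v form a 41523, or p, p+1, q+1 form a 321.
  descents-clash : ∀ {v p q} → No4152Around s (suc M) v → s p ≡ v → s (suc p) < v →
                   p < q → v < s q → s (suc q) < v → suc q < suc M → ⊥
  descents-clash {v} {p} {q} no4152 sp≡v p′<v p<q v<sq q′<v sq<N with <-cmp (s (suc p)) (s (suc q))
  ... | tri< lt _ _ =
    no4152 (n<1+n p) sp<q (n<1+n q) sq<N lt q′<v (≤-reflexive (sym sp≡v)) (subst (_< s q) (sym sp≡v) v<sq)
    where
    sp<q : suc p < q
    sp<q = ≤∧≢⇒< p<q (λ e → <-asym p′<v (subst (λ x → v < s x) (sym e) v<sq))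
  ... | tri≈ _ e _ = <-irrefl (suc-injective (injective (<-trans (s≤s p<q) sq<N) sq<N e)) p<q
  ... | tri> _ _ gt =
    avoids321 (p , suc p , suc q , n<1+n p , s≤s p<q , sq<N , subst (s (suc p) <_) (sym sp≡v) p′<v , gt)

  lastMax+descent⇒appendable : s M ≡ M → HasDescent s (suc M) → ∃ λ v → v < M × Appendable s (suc M) v
  lastMax+descent⇒appendable sM≡M (r , sr<N , dr) with maximalDescent? s M
  ... | inj₂ none = ⊥-elim (none (s≤s⁻¹ sr<N) dr)
  ... | inj₁ m    = s position , top<M , maximalDescent-appendable injective m
    where
    open MaximalDescent m
    top<M : s position < M
    top<M = ≤∧≢⇒< (s≤s⁻¹ (bounded (m<n⇒m<1+n position<K)))
                  (λ e → <-irrefl (injective (m<n⇒m<1+n position<K) (n<1+n M) (trans e (sym sM≡M))) position<K)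

  module _ (S : SurjectiveBelow s (suc M)) where

    appendable⇒descent : ∀ {v} → v < M → Appendable s (suc M) v →
                         ∃ λ p → suc p < suc M × s p ≡ v × s (suc p) < v
    appendable⇒descent {v} v<M V with S (m<n⇒m<1+n v<M) | S (n<1+n M)
    ... | p , p<N , sp≡v | q , q<N , sq≡M = p , sp<N , sp≡v , next<v
      where
      open Appendable V
      sp<N : suc p < suc M
      sp<N = ≤-<-trans (larger-after noInversionAbove p<N sp≡v (subst (v <_) (sym sq≡M) v<M)) q<N
      next<v : s (suc p) < v
      next<v with <-cmp (s (suc p)) v
      ... | tri< lt _ _ = lt
      ... | tri≈ _ e _  = ⊥-elim (<-irrefl (injective p<N sp<N (trans sp≡v (sym e))) (n<1+n p))
      ... | tri> _ _ gt = ⊥-elim (noAscentAfter sp<N sp≡v (subst (_< s (suc p)) (sym sp≡v) gt))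

    appendable⇒hasDescent : ∀ {v} → v < M → Appendable s (suc M) v → HasDescent s (suc M)
    appendable⇒hasDescent v<M V with appendable⇒descent v<M V
    ... | p , sp<N , sp≡v , p′<v = p , sp<N , subst (s (suc p) <_) (sym sp≡v) p′<v

    appendable⇒lastMax : ∀ {v} → v < M → Appendable s (suc M) v → s M ≡ M
    appendable⇒lastMax {v} v<M V with appendable⇒descent v<M V | S (n<1+n M)
    ... | p , sp<N , sp≡v , p′<v | q , q<N , sq≡M with m<1+n⇒m<n∨m≡n q<N
    ...   | inj₂ refl = sq≡M
    ...   | inj₁ q<M  = ⊥-elim (descents-clash no4152Around sp≡v p′<v p<q v<sq q′<v (s≤s q<M))
      where
      open Appendable V
      v<sq = subst (v <_) (sym sq≡M) v<M
      p<q = larger-after noInversionAbove (<-trans (n<1+n p) sp<N) sp≡v v<sq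
      q′<sq : s (suc q) < s q
      q′<sq = subst (s (suc q) <_) (sym sq≡M)
                (≤∧≢⇒< (s≤s⁻¹ (bounded (s≤s q<M)))
                       (λ e → <-irrefl (injective q<N (s≤s q<M) (trans sq≡M (sym e))) (n<1+n q)))
      q′<v = inversion-below noInversionAbove (n<1+n q) (s≤s q<M) q′<sq

    no-two-appendable : ∀ {v w} → v < w → w < M → Appendable s (suc M) v → Appendable s (suc M) w → ⊥
    no-two-appendable {v} v<w w<M V W with appendable⇒descent (<-trans v<w w<M) V | appendable⇒descent w<M W
    ... | p , sp<N , sp≡v , p′<v | q , sq<N , sq≡w , q′<w =
      descents-clash no4152Around sp≡v p′<v p<q v<sq q′<v sq<N
      where
      open Appendable V
      v<sq = subst (v <_) (sym sq≡w) v<w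
      p<q = larger-after noInversionAbove (<-trans (n<1+n p) sp<N) sp≡v v<sq
      q′<v = inversion-below noInversionAbove (n<1+n q) sq<N (subst (s (suc q) <_) (sym sq≡w) q′<w)

    appendable-unique : ∀ {v w} → v < M → w < M → Appendable s (suc M) v → Appendable s (suc M) w → v ≡ w
    appendable-unique {v} {w} v<M w<M V W with <-cmp v w
    ... | tri< v<w _ _ = ⊥-elim (no-two-appendable v<w w<M V W)
    ... | tri≈ _ e _   = e
    ... | tri> _ _ w<v = ⊥-elim (no-two-appendable w<v v<M W V)

-- Positions outside the word read as 0; all statements restrict to positions < n.
seq : ∀ {m n} → Vec (Fin m) n → ℕ → ℕ
seq []       _       = 0
seq (x ∷ xs) zero    = toℕ x
seq (x ∷ xs) (suc k) = seq xs k

seq-lookup : ∀ {m n} (xs : Vec (Fin m) n) (i : Fin n) → seq xs (toℕ i) ≡ toℕ (lookup xs i)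
seq-lookup (x ∷ xs) fzero    = refl
seq-lookup (x ∷ xs) (fsuc i) = seq-lookup xs i

seq-fromℕ< : ∀ {m n} (xs : Vec (Fin m) n) {k} (p : k < n) → seq xs k ≡ toℕ (lookup xs (fromℕ< p))
seq-fromℕ< xs p = trans (cong (seq xs) (sym (toℕ-fromℕ< p))) (seq-lookup xs (fromℕ< p))

seq-bounded : ∀ {m n} (xs : Vec (Fin m) n) {k} → k < n → seq xs k < m
seq-bounded (x ∷ xs) {zero}  _       = toℕ<n x
seq-bounded (x ∷ xs) {suc k} (s≤s p) = seq-bounded xs p

seq-injective : ∀ {m n} (xs ys : Vec (Fin m) n) → (∀ {k} → k < n → seq xs k ≡ seq ys k) → xs ≡ ys
seq-injective []       []       _  = refl
seq-injective (x ∷ xs) (y ∷ ys) eq =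
  cong₂ _∷_ (toℕ-injective (eq (s≤s z≤n))) (seq-injective xs ys (eq ∘ s≤s))

seq-∷ʳ-< : ∀ {m n} (xs : Vec (Fin m) n) (y : Fin m) {k} → k < n → seq (xs ∷ʳ y) k ≡ seq xs k
seq-∷ʳ-< (x ∷ xs) y {zero}  _       = refl
seq-∷ʳ-< (x ∷ xs) y {suc k} (s≤s p) = seq-∷ʳ-< xs y p

seq-∷ʳ-last : ∀ {m n} (xs : Vec (Fin m) n) (y : Fin m) → seq (xs ∷ʳ y) n ≡ toℕ y
seq-∷ʳ-last []       y = refl
seq-∷ʳ-last (x ∷ xs) y = seq-∷ʳ-last xs y

toℕ-punchIn : ∀ {n} (i : Fin (suc n)) (j : Fin n) → toℕ (punchIn i j) ≡ punchInℕ (toℕ i) (toℕ j)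
toℕ-punchIn fzero            j        = refl
toℕ-punchIn {suc n} (fsuc i) fzero    = refl
toℕ-punchIn {suc n} (fsuc i) (fsuc j) = cong suc (toℕ-punchIn i j)

seq-map-punchIn : ∀ {m n} (v : Fin (suc m)) (xs : Vec (Fin m) n) {k} → k < n →
                  seq (map (punchIn v) xs) k ≡ punchInℕ (toℕ v) (seq xs k)
seq-map-punchIn v (x ∷ xs) {zero}  _       = toℕ-punchIn v x
seq-map-punchIn v (x ∷ xs) {suc k} (s≤s p) = seq-map-punchIn v xs p

appendLast : ∀ {n} → Word n → Fin (suc n) → Word (suc n)
appendLast σ v = map (punchIn v) σ ∷ʳ v

appendLast-appends : ∀ {n} (σ : Word n) (v : Fin (suc n)) → Appends (seq σ) (seq (appendLast σ v)) n (toℕ v)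
appendLast-appends σ v = record
  { shifted = λ p → trans (seq-∷ʳ-< (map (punchIn v) σ) v p) (seq-map-punchIn v σ p)
  ; last    = seq-∷ʳ-last (map (punchIn v) σ) v
  ; v≤N     = s≤s⁻¹ (toℕ<n v) }

lastEntry : ∀ {n} → Word (suc n) → Fin (suc n)
lastEntry {n} π = lookup π (fromℕ n)

toℕ-lastEntry : ∀ {n} (π : Word (suc n)) → toℕ (lastEntry π) ≡ seq π n
toℕ-lastEntry {n} π = trans (sym (seq-lookup π (fromℕ n))) (cong (seq π) (toℕ-fromℕ n))

-- punchOut, with an arbitrary default where it is undefined; dropLast only
-- uses that default on non-permutations.
punchOutOr : ∀ {n} → Fin n → Fin (suc n) → Fin (suc n) → Fin n
punchOutOr d i j with i FinP.≟ j
... | yes _   = d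
... | no  i≢j = punchOut i≢j

punchIn-punchOutOr : ∀ {n} (d : Fin n) {i j : Fin (suc n)} → i ≢ j → punchIn i (punchOutOr d i j) ≡ j
punchIn-punchOutOr d {i} {j} i≢j with i FinP.≟ j
... | yes i≡j = ⊥-elim (i≢j i≡j)
... | no  i≢j = punchIn-punchOut i≢j

dropLast : ∀ {n} → Word (suc n) → Word n
dropLast π = tabulate (λ i → punchOutOr i (lastEntry π) (lookup π (inject₁ i)))

dropLast-appends : ∀ {n} (π : Word (suc n)) → InjectiveBelow (seq π) (suc n) →
                   Appends (seq (dropLast π)) (seq π) n (seq π n)
dropLast-appends {n} π inj = record
  { shifted = shifted
  ; last    = refl
  ; v≤N     = s≤s⁻¹ (seq-bounded π (n<1+n n)) }
  where
  shifted : ∀ {k} → k < n → seq π k ≡ punchInℕ (seq π n) (seq (dropLast π) k)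
  shifted {k} p = begin
    seq π k                                     ≡⟨ seq-k ⟩
    toℕ x                                       ≡⟨ cong toℕ (sym (punchIn-punchOutOr i last≢x)) ⟩
    toℕ (punchIn (lastEntry π) (punchOutOr i (lastEntry π) x))
                                                ≡⟨ toℕ-punchIn (lastEntry π) _ ⟩
    punchInℕ (toℕ (lastEntry π)) (toℕ (punchOutOr i (lastEntry π) x))
                                                ≡⟨ cong₂ punchInℕ (toℕ-lastEntry π) (sym seq-dropLast) ⟩
    punchInℕ (seq π n) (seq (dropLast π) k)     ∎
    where
    open ≡-Reasoning
    i = fromℕ< p
    x = lookup π (inject₁ i)
    seq-k : seq π k ≡ toℕ x
    seq-k = trans (cong (seq π) (sym (trans (toℕ-inject₁ i) (toℕ-fromℕ< p)))) (seq-lookup π (inject₁ i))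
    seq-dropLast : seq (dropLast π) k ≡ toℕ (punchOutOr i (lastEntry π) x)
    seq-dropLast = trans (seq-fromℕ< (dropLast π) p) (cong toℕ (lookup∘tabulate _ i))
    last≢x : lastEntry π ≢ x
    last≢x e = <-irrefl (inj (m<n⇒m<1+n p) (n<1+n n)
                             (trans seq-k (trans (cong toℕ (sym e)) (toℕ-lastEntry π)))) p

appendLast-dropLast : ∀ {n} (π : Word (suc n)) → InjectiveBelow (seq π) (suc n) →
                      appendLast (dropLast π) (lastEntry π) ≡ π
appendLast-dropLast {n} π inj = seq-injective _ _ same
  where
  open Appends
  same : ∀ {k} → k < suc n → seq (appendLast (dropLast π) (lastEntry π)) k ≡ seq π k
  same {k} p with m<1+n⇒m<n∨m≡n p
  ... | inj₁ k<n  = trans (shifted (appendLast-appends (dropLast π) (lastEntry π)) k<n)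
                          (trans (cong (λ v → punchInℕ v (seq (dropLast π) k)) (toℕ-lastEntry π))
                                 (sym (shifted (dropLast-appends π inj) k<n)))
  ... | inj₂ refl = trans (last (appendLast-appends (dropLast π) (lastEntry π))) (toℕ-lastEntry π)

lastEntry-appendLast : ∀ {n} (σ : Word n) (v : Fin (suc n)) → lastEntry (appendLast σ v) ≡ v
lastEntry-appendLast σ v =
  toℕ-injective (trans (toℕ-lastEntry (appendLast σ v)) (Appends.last (appendLast-appends σ v)))

dropLast-appendLast : ∀ {n} (σ : Word n) (v : Fin (suc n)) → InjectiveBelow (seq (appendLast σ v)) (suc n) →
                      dropLast (appendLast σ v) ≡ σ
dropLast-appendLast {n} σ v inj = seq-injective _ _ same
  where
  open Appends
  π = appendLast σ v
  same : ∀ {k} → k < n → seq (dropLast π) k ≡ seq σ k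
  same {k} p = punchInℕ-injective (toℕ v)
    (trans (cong (λ w → punchInℕ w (seq (dropLast π) k)) (sym (last (appendLast-appends σ v))))
           (trans (sym (shifted (dropLast-appends π inj) p)) (shifted (appendLast-appends σ v) p)))

module _ {n : ℕ} (π : Word n) where

  private
    s : ℕ → ℕ
    s = seq π

  fromℕ<-mono-< : ∀ {i j} (p : i < n) (q : j < n) → i < j → toℕ (fromℕ< p) < toℕ (fromℕ< q)
  fromℕ<-mono-< p q = subst₂ _<_ (sym (toℕ-fromℕ< p)) (sym (toℕ-fromℕ< q))

  seq-<⇒lookup-< : ∀ {i j} (p : i < n) (q : j < n) → s i < s j →
                   toℕ (lookup π (fromℕ< p)) < toℕ (lookup π (fromℕ< q))
  seq-<⇒lookup-< p q = subst₂ _<_ (seq-fromℕ< π p) (seq-fromℕ< π q)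

  lookup-<⇒seq-< : ∀ (i j : Fin n) → toℕ (lookup π i) < toℕ (lookup π j) → s (toℕ i) < s (toℕ j)
  lookup-<⇒seq-< i j = subst₂ _<_ (sym (seq-lookup π i)) (sym (seq-lookup π j))

  isPerm⇔injective : IsPerm π ⇔ InjectiveBelow s n
  isPerm⇔injective = mk⇔
    (λ perm {i} {j} p q e → trans (sym (toℕ-fromℕ< p))
       (trans (cong toℕ (perm _ _ (toℕ-injective (trans (sym (seq-fromℕ< π p)) (trans e (seq-fromℕ< π q))))))
              (toℕ-fromℕ< q)))
    (λ inj i j e → toℕ-injective
       (inj (toℕ<n i) (toℕ<n j) (trans (seq-lookup π i) (trans (cong toℕ e) (sym (seq-lookup π j))))))

  contains321⇔has321 : Contains321 π ⇔ Has321 s n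
  contains321⇔has321 = mk⇔
    (λ (i , j , k , i<j , j<k , ji , kj) →
       toℕ i , toℕ j , toℕ k , i<j , j<k , toℕ<n k , lookup-<⇒seq-< j i ji , lookup-<⇒seq-< k j kj)
    (λ (i , j , k , i<j , j<k , k<n , ji , kj) →
       let j<n = <-trans j<k k<n ; i<n = <-trans i<j j<n in
       fromℕ< i<n , fromℕ< j<n , fromℕ< k<n , fromℕ<-mono-< i<n j<n i<j , fromℕ<-mono-< j<n k<n j<k ,
       seq-<⇒lookup-< j<n i<n ji , seq-<⇒lookup-< k<n j<n kj)

  contains41523⇔has41523 : Contains41523 π ⇔ Has41523 s n
  contains41523⇔has41523 = mk⇔
    (λ (a , b , c , d , e , ab , bc , cd , de , bd , de′ , ea , ac) →
       toℕ a , toℕ b , toℕ c , toℕ d , toℕ e , ab , bc , cd , de , toℕ<n e ,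
       lookup-<⇒seq-< b d bd , lookup-<⇒seq-< d e de′ , lookup-<⇒seq-< e a ea , lookup-<⇒seq-< a c ac)
    (λ (a , b , c , d , e , ab , bc , cd , de , e<n , bd , de′ , ea , ac) →
       let d<n = <-trans de e<n ; c<n = <-trans cd d<n ; b<n = <-trans bc c<n ; a<n = <-trans ab b<n in
       fromℕ< a<n , fromℕ< b<n , fromℕ< c<n , fromℕ< d<n , fromℕ< e<n ,
       fromℕ<-mono-< a<n b<n ab , fromℕ<-mono-< b<n c<n bc ,
       fromℕ<-mono-< c<n d<n cd , fromℕ<-mono-< d<n e<n de ,
       seq-<⇒lookup-< b<n d<n bd , seq-<⇒lookup-< d<n e<n de′ ,
       seq-<⇒lookup-< e<n a<n ea , seq-<⇒lookup-< a<n c<n ac)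

fishburnViolation⇔pair : ∀ {n} (π : Word n) → FishburnViolation π ⇔ HasFishburnPair (seq π) n
fishburnViolation⇔pair {zero}  π = mk⇔ (λ ()) (λ ())
fishburnViolation⇔pair {suc m} π = mk⇔ to from
  where
  s = seq π
  to : FishburnViolation π → HasFishburnPair s (suc m)
  to (i , j , i<j , ji , i<i+1 , eq) =
    toℕ i , toℕ j , s≤s (toℕ<n i) , subst (_< toℕ j) (toℕ-inject₁ i) i<j , toℕ<n j ,
    subst (s (toℕ j) <_) at-i (lookup-<⇒seq-< π j (inject₁ i) ji) ,
    subst (_< s (suc (toℕ i))) at-i (lookup-<⇒seq-< π (inject₁ i) (fsuc i) i<i+1) ,
    trans (sym at-i) (trans (seq-lookup π (inject₁ i)) (trans eq (cong suc (sym (seq-lookup π j)))))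
    where
    at-i : s (toℕ (inject₁ i)) ≡ s (toℕ i)
    at-i = cong s (toℕ-inject₁ i)
  from : HasFishburnPair s (suc m) → FishburnViolation π
  from (i , j , si<n , i<j , j<n , ji , i<i+1 , eq) =
    i′ , j′ , subst₂ _<_ (sym toℕ-i′) (sym (toℕ-fromℕ< j<n)) i<j ,
    subst₂ _<_ (seq-fromℕ< π j<n) at-i ji ,
    subst₂ _<_ at-i at-i+1 i<i+1 ,
    trans (sym at-i) (trans eq (cong suc (seq-fromℕ< π j<n)))
    where
    i<m = s≤s⁻¹ si<n
    i′ = fromℕ< i<m
    j′ = fromℕ< j<n
    toℕ-i′ : toℕ (inject₁ i′) ≡ i
    toℕ-i′ = trans (toℕ-inject₁ i′) (toℕ-fromℕ< i<m)
    at-i : s i ≡ toℕ (lookup π (inject₁ i′))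
    at-i = trans (cong s (sym toℕ-i′)) (seq-lookup π (inject₁ i′))
    at-i+1 : s (suc i) ≡ toℕ (lookup π (fsuc i′))
    at-i+1 = trans (cong (s ∘ suc) (sym (toℕ-fromℕ< i<m))) (seq-lookup π (fsuc i′))

T-yes-no-no-no : ∀ {A B C D : Set} (a : Dec A) (b : Dec B) (c : Dec C) (d : Dec D) →
                 T (does a ∧ not (does b) ∧ not (does c) ∧ not (does d)) ⇔ (A × ¬ B × ¬ C × ¬ D)
T-yes-no-no-no (yes a) (no ¬b) (no ¬c) (no ¬d) = mk⇔ (λ _ → a , ¬b , ¬c , ¬d) (λ _ → tt)
T-yes-no-no-no (no ¬a) _       _       _       = mk⇔ (λ ()) (λ (a , _) → ¬a a)
T-yes-no-no-no (yes _) (yes b) _       _       = mk⇔ (λ ()) (λ (_ , ¬b , _) → ¬b b)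
T-yes-no-no-no (yes _) (no _)  (yes c) _       = mk⇔ (λ ()) (λ (_ , _ , ¬c , _) → ¬c c)
T-yes-no-no-no (yes _) (no _)  (no _)  (yes d) = mk⇔ (λ ()) (λ (_ , _ , _ , ¬d) → ¬d d)

T-yes-yes : ∀ {A B : Set} (a : Dec A) (b : Dec B) → T (does a ∧ does b) ⇔ (A × B)
T-yes-yes (yes a) (yes b) = mk⇔ (λ _ → a , b) (λ _ → tt)
T-yes-yes (no ¬a) _       = mk⇔ (λ ()) (¬a ∘ proj₁)
T-yes-yes (yes _) (no ¬b) = mk⇔ (λ ()) (¬b ∘ proj₂)

T-isCounted : ∀ {n} (π : Word n) →
              T (isCounted π) ⇔ (IsPerm π × ¬ FishburnViolation π × ¬ Contains321 π × ¬ Contains41523 π)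
T-isCounted π = T-yes-no-no-no (isPerm? π) (fishburnViolation? π) (contains321? π) (contains41523? π)

counted⇒admissible : ∀ {n} (π : Word n) → T (isCounted π) → Admissible (seq π) n
counted⇒admissible π c with Equivalence.to (T-isCounted π) c
... | perm , noFishburn , no321 , no41523 = record
  { injective   = isPerm⇔injective π .to perm
  ; bounded     = seq-bounded π
  ; fishburn    = noFishburn ∘ fishburnViolation⇔pair π .from
  ; avoids321   = no321 ∘ contains321⇔has321 π .from
  ; avoids41523 = no41523 ∘ contains41523⇔has41523 π .from }
  where open Equivalence

admissible⇒counted : ∀ {n} (π : Word n) → Admissible (seq π) n → T (isCounted π)
admissible⇒counted π G = T-isCounted π .from
  ( isPerm⇔injective π .from injective
  , fishburn ∘ fishburnViolation⇔pair π .to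
  , avoids321 ∘ contains321⇔has321 π .to
  , avoids41523 ∘ contains41523⇔has41523 π .to )
  where
  open Equivalence
  open Admissible G

perm⇒surjective : ∀ {n} (σ : Word n) → IsPerm σ → SurjectiveBelow (seq σ) n
perm⇒surjective {suc n} σ perm {x} x<n with FinP.any? (λ i → fromℕ< x<n FinP.≟ lookup σ i)
... | yes (i , e) = toℕ i , toℕ<n i , trans (seq-lookup σ i) (trans (cong toℕ (sym e)) (toℕ-fromℕ< x<n))
... | no missing  = ⊥-elim (1+n≰n (FinP.injective⇒≤ squeeze-injective))
  where
  squeeze : Fin (suc n) → Fin n
  squeeze i = punchOut (λ e → missing (i , e))
  squeeze-injective : ∀ {i j} → squeeze i ≡ squeeze j → i ≡ j
  squeeze-injective {i} {j} = perm i j ∘ FinP.punchOut-injective (λ e → missing (i , e)) (λ e → missing (j , e))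

-- Counting by the last letter

Σ-T-≡ : ∀ {A : Set} {P : A → Bool} {x y} {p : T (P x)} {q : T (P y)} → x ≡ y →
        _≡_ {A = Σ A (T ∘ P)} (x , p) (y , q)
Σ-T-≡ {p = p} {q} refl = cong (_ ,_) (T-irrelevant p q)

-- Stated for an abstract P: with P = isCounted, comparing the proof components
-- would make the typechecker unfold the decision procedures of Defs.
module _ {A B : Set} {P : A → Bool} where

  Σ-T-↔ : (f : Σ A (T ∘ P) → B) (g : B → A) (g-P : ∀ b → T (P (g b))) →
          (∀ b → f (g b , g-P b) ≡ b) → (∀ x → g (f x) ≡ proj₁ x) → Σ A (T ∘ P) ↔ B
  Σ-T-↔ f g g-P f∘g g∘f = mk↔ₛ′ f (λ b → g b , g-P b) f∘g (λ x → Σ-T-≡ (g∘f x))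

cancel-⊤ : ∀ {X : Set} {k} → (X ⊎ ⊤) ↔ Fin k → X ↔ Fin (pred k)
cancel-⊤ {k = zero}  F = ⊥-elim (FinP.¬Fin0 (Inverse.to F (inj₂ tt)))
cancel-⊤ {X} {suc k} F = mk↔ₛ′ to′ from′ to∘from from∘to
  where
  open Inverse F
  hole : Fin (suc k)
  hole = to (inj₂ tt)
  hole≢ : ∀ x → hole ≢ to (inj₁ x)
  hole≢ x e with trans (sym (strictlyInverseʳ (inj₂ tt))) (trans (cong from e) (strictlyInverseʳ (inj₁ x)))
  ... | ()
  preimage : ∀ y → ∃ λ x → from (punchIn hole y) ≡ inj₁ x
  preimage y with from (punchIn hole y) in eq
  ... | inj₁ x  = x , refl
  ... | inj₂ tt = ⊥-elim (FinP.punchInᵢ≢i hole y (trans (sym (strictlyInverseˡ _)) (cong to eq)))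
  to′ : X → Fin k
  to′ x = punchOut (hole≢ x)
  from′ : Fin k → X
  from′ y = proj₁ (preimage y)
  to∘from : ∀ y → to′ (from′ y) ≡ y
  to∘from y = trans (FinP.punchOut-cong hole (trans (cong to (sym (proj₂ (preimage y)))) (strictlyInverseˡ _)))
                    (FinP.punchOut-punchIn hole)
  from∘to : ∀ x → from′ (to′ x) ≡ x
  from∘to x = inj₁-injective (trans (sym (proj₂ (preimage (to′ x))))
                (trans (cong from (punchIn-punchOut (hole≢ x))) (strictlyInverseʳ (inj₁ x))))

Counted : ℕ → Set
Counted n = Σ (Word n) (λ π → T (isCounted π))

Appendings : ∀ {n} → Word n → Set
Appendings {n} σ = Σ (Fin (suc n)) (λ v → T (isCounted (appendLast σ v)))

counted⇒injective : ∀ {n} (π : Word n) → T (isCounted π) → InjectiveBelow (seq π) n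
counted⇒injective π = Admissible.injective ∘ counted⇒admissible π

dropLast-counted : ∀ {n} (π : Word (suc n)) → T (isCounted π) → T (isCounted (dropLast π))
dropLast-counted π c = admissible⇒counted (dropLast π)
  (proj₁ (admissible-append⁻ (dropLast-appends π (counted⇒injective π c)) (counted⇒admissible π c)))

appendLast-counted⇔appendable : ∀ {n} (σ : Word n) → T (isCounted σ) → (v : Fin (suc n)) →
                                T (isCounted (appendLast σ v)) ⇔ Appendable (seq σ) n (toℕ v)
appendLast-counted⇔appendable σ c v = mk⇔
  (λ c′ → proj₂ (admissible-append⁻ E (counted⇒admissible (appendLast σ v) c′)))
  (λ V → admissible⇒counted (appendLast σ v) (admissible-append⁺ E (counted⇒admissible σ c) V))
  where E = appendLast-appends σ v

counted-suc↔ : ∀ n → Counted (suc n) ↔ Σ (Counted n) (Appendings ∘ proj₁)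
counted-suc↔ n = Σ-T-↔ split (λ ((σ , _) , (v , _)) → appendLast σ v) (λ (_ , (_ , c)) → c)
  (λ ((σ , _) , (v , c)) →
     pair-≡ (dropLast-appendLast σ v (counted⇒injective (appendLast σ v) c)) (lastEntry-appendLast σ v))
  (λ (π , c) → appendLast-dropLast π (counted⇒injective π c))
  where
  split : Counted (suc n) → Σ (Counted n) (Appendings ∘ proj₁)
  split (π , c) = (dropLast π , dropLast-counted π c) ,
                  (lastEntry π , subst (T ∘ isCounted) (sym (appendLast-dropLast π (counted⇒injective π c))) c)
  pair-≡ : ∀ {σ σ′ : Word n} {v v′ : Fin (suc n)} {c₀ c₀′ c c′} → σ′ ≡ σ → v′ ≡ v →
           _≡_ {A = Σ (Counted n) (Appendings ∘ proj₁)}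
               ((σ′ , c₀′) , (v′ , c′)) ((σ , c₀) , (v , c))
  pair-≡ {c₀ = c₀} {c₀′} {c} {c′} refl refl =
    cong₂ (λ a b → ((_ , a) , (_ , b))) (T-irrelevant c₀′ c₀) (T-irrelevant c′ c)

-- A Boolean, so that its proofs are unique (T-irrelevant).
endsInMaxWithDescent : ∀ {m} → Word (suc m) → Bool
endsInMaxWithDescent {m} σ = does (seq σ m ≟ m) ∧ does (hasDescent? (seq σ) (suc m))

T-endsInMaxWithDescent : ∀ {m} (σ : Word (suc m)) →
                         T (endsInMaxWithDescent σ) ⇔ (seq σ m ≡ m × HasDescent (seq σ) (suc m))
T-endsInMaxWithDescent {m} σ = T-yes-yes (seq σ m ≟ m) (hasDescent? (seq σ) (suc m))

module _ {m : ℕ} (σ : Word (suc m)) (c : T (isCounted σ)) where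
  open Equivalence

  private
    G : Admissible (seq σ) (suc m)
    G = counted⇒admissible σ c

    S : SurjectiveBelow (seq σ) (suc m)
    S = perm⇒surjective σ (proj₁ (T-isCounted σ .to c))

    top second : Fin (suc (suc m))
    top    = fromℕ (suc m)
    second = inject₁ (fromℕ m)

    toℕ-top : toℕ top ≡ suc m
    toℕ-top = toℕ-fromℕ (suc m)

    toℕ-second : toℕ second ≡ m
    toℕ-second = trans (toℕ-inject₁ (fromℕ m)) (toℕ-fromℕ m)

    small : ∀ {v} → v ≢ top → v ≢ second → toℕ v < m
    small {v} ≢top ≢second =
      ≤∧≢⇒< (s≤s⁻¹ (≤∧≢⇒< (s≤s⁻¹ (toℕ<n v)) (λ e → ≢top (toℕ-injective (trans e (sym toℕ-top))))))
            (λ e → ≢second (toℕ-injective (trans e (sym toℕ-second))))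

    smallAppendable : T (endsInMaxWithDescent σ) → ∃ λ v → v < m × Appendable (seq σ) (suc m) v
    smallAppendable e = let (lastMax , d) = T-endsInMaxWithDescent σ .to e in lastMax+descent⇒appendable G lastMax d

    smallLetter : T (endsInMaxWithDescent σ) → Fin (suc (suc m))
    smallLetter e = fromℕ< (<-trans (proj₁ (proj₂ (smallAppendable e))) (<-trans (n<1+n m) (n<1+n (suc m))))

    toℕ-smallLetter : ∀ e → toℕ (smallLetter e) ≡ proj₁ (smallAppendable e)
    toℕ-smallLetter e = toℕ-fromℕ< _

    smallLetter<m : ∀ e → toℕ (smallLetter e) < m
    smallLetter<m e = subst (_< m) (sym (toℕ-smallLetter e)) (proj₁ (proj₂ (smallAppendable e)))

    letter : Fin 2 ⊎ T (endsInMaxWithDescent σ) → Fin (suc (suc m))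
    letter (inj₁ fzero)        = top
    letter (inj₁ (fsuc fzero)) = second
    letter (inj₂ e)            = smallLetter e

    letter-appendable : ∀ x → Appendable (seq σ) (suc m) (toℕ (letter x))
    letter-appendable (inj₁ fzero)        = subst (Appendable (seq σ) (suc m)) (sym toℕ-top)
                                                  (appendable-max (Admissible.bounded G))
    letter-appendable (inj₁ (fsuc fzero)) = subst (Appendable (seq σ) (suc m)) (sym toℕ-second)
                                                  (appendable-pred-max (Admissible.bounded G))
    letter-appendable (inj₂ e)            = subst (Appendable (seq σ) (suc m)) (sym (toℕ-smallLetter e))
                                                  (proj₂ (proj₂ (smallAppendable e)))

    classify : (v : Fin (suc (suc m))) → Appendable (seq σ) (suc m) (toℕ v) →
               Dec (v ≡ top) → Dec (v ≡ second) → Fin 2 ⊎ T (endsInMaxWithDescent σ)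
    classify v V (yes _)    _            = inj₁ fzero
    classify v V (no _)     (yes _)      = inj₁ (fsuc fzero)
    classify v V (no ≢top) (no ≢second) = inj₂ (T-endsInMaxWithDescent σ .from
      (appendable⇒lastMax G S v<m V , appendable⇒hasDescent G S v<m V))
      where v<m = small ≢top ≢second

    top≢second : top ≢ second
    top≢second e = <-irrefl (trans (sym toℕ-second) (trans (cong toℕ (sym e)) toℕ-top)) (n<1+n m)

    classify-letter : ∀ x V d₁ d₂ → classify (letter x) V d₁ d₂ ≡ x
    classify-letter (inj₁ fzero)        V (yes _)  _       = refl
    classify-letter (inj₁ fzero)        V (no ≢)   _       = ⊥-elim (≢ refl)
    classify-letter (inj₁ (fsuc fzero)) V (yes e)  _       = ⊥-elim (top≢second (sym e))
    classify-letter (inj₁ (fsuc fzero)) V (no _)   (yes _) = refl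
    classify-letter (inj₁ (fsuc fzero)) V (no _)   (no ≢)  = ⊥-elim (≢ refl)
    classify-letter (inj₂ e)            V (yes e′) _       =
      ⊥-elim (<-asym (smallLetter<m e) (subst (m <_) (sym (trans (cong toℕ e′) toℕ-top)) (n<1+n m)))
    classify-letter (inj₂ e)            V (no _)   (yes e′) =
      ⊥-elim (<-irrefl (trans (cong toℕ e′) toℕ-second) (smallLetter<m e))
    classify-letter (inj₂ e)            V (no _)   (no _)  = cong inj₂ (T-irrelevant _ _)

    letter-classify : ∀ v V d₁ d₂ → letter (classify v V d₁ d₂) ≡ v
    letter-classify v V (yes refl) _          = refl
    letter-classify v V (no _)     (yes refl) = refl
    letter-classify v V (no ≢top)  (no ≢second) = toℕ-injective (trans (toℕ-smallLetter e)
      (appendable-unique G S (proj₁ (proj₂ (smallAppendable e))) (small ≢top ≢second)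
                             (proj₂ (proj₂ (smallAppendable e))) V))
      where e = T-endsInMaxWithDescent σ .from (appendable⇒lastMax G S (small ≢top ≢second) V ,
                                                appendable⇒hasDescent G S (small ≢top ≢second) V)

  appendings↔ : Appendings σ ↔ (Fin 2 ⊎ T (endsInMaxWithDescent σ))
  appendings↔ = Σ-T-↔ to′ letter (λ x → appendable⇔ (letter x) .from (letter-appendable x))
    (λ x → classify-letter x _ _ _)
    (λ (v , c′) → letter-classify v (appendable⇔ v .to c′) (v FinP.≟ top) (v FinP.≟ second))
    where
    appendable⇔ = appendLast-counted⇔appendable σ c
    to′ : Appendings σ → Fin 2 ⊎ T (endsInMaxWithDescent σ)
    to′ (v , c′) = classify v (appendable⇔ v .to c′) (v FinP.≟ top) (v FinP.≟ second)

EndsInMaxWithDescent : ℕ → Set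
EndsInMaxWithDescent m = Σ (Counted (suc m)) (T ∘ endsInMaxWithDescent ∘ proj₁)

seq-allFin : ∀ {m k} → k < m → seq (allFin m) k ≡ k
seq-allFin {m} p = trans (seq-fromℕ< (allFin m) p) (trans (cong toℕ (lookup-allFin _)) (toℕ-fromℕ< p))

identity-counted : ∀ m → T (isCounted (allFin m))
identity-counted m = admissible⇒counted (allFin m) (identity-admissible seq-allFin)

identity-noDescent : ∀ m → ¬ HasDescent (seq (allFin m)) m
identity-noDescent m (r , sr<m , d) =
  <-asym (n<1+n r) (subst₂ _<_ (seq-allFin sr<m) (seq-allFin (<-trans (n<1+n r) sr<m)) d)

module _ (m : ℕ) where
  open Equivalence

  private
    top : Fin (suc m)
    top = fromℕ m

    appendMax : ∀ τ → Appends (seq τ) (seq (appendLast τ top)) m m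
    appendMax τ = subst (Appends (seq τ) (seq (appendLast τ top)) m) (toℕ-fromℕ m) (appendLast-appends τ top)

    appendMax-counted : ∀ τ → T (isCounted τ) → T (isCounted (appendLast τ top))
    appendMax-counted τ c = appendLast-counted⇔appendable τ c top .from
      (subst (Appendable (seq τ) m) (sym (toℕ-fromℕ m)) (appendable-max (seq-bounded τ)))

    appendMax-endsInMax : ∀ τ → HasDescent (seq τ) m → T (endsInMaxWithDescent (appendLast τ top))
    appendMax-endsInMax τ d =
      T-endsInMaxWithDescent (appendLast τ top) .from
        (Appends.last (appendMax τ) , hasDescent-append⁺ (appendMax τ) d)

    extendIf : (τ : Word m) → T (isCounted τ) → Dec (HasDescent (seq τ) m) → EndsInMaxWithDescent m ⊎ ⊤
    extendIf τ c (yes d) = inj₁ ((appendLast τ top , appendMax-counted τ c) , appendMax-endsInMax τ d)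
    extendIf τ c (no _)  = inj₂ tt

    shrink : EndsInMaxWithDescent m ⊎ ⊤ → Counted m
    shrink (inj₁ ((σ , c) , _)) = dropLast σ , dropLast-counted σ c
    shrink (inj₂ tt)            = allFin m , identity-counted m

    shrink-extendIf : ∀ τ c d → shrink (extendIf τ c d) ≡ (τ , c)
    shrink-extendIf τ c (yes _) = Σ-T-≡ {P = isCounted}
      (dropLast-appendLast τ top (counted⇒injective (appendLast τ top) (appendMax-counted τ c)))
    shrink-extendIf τ c (no ¬d) = Σ-T-≡ {P = isCounted} (seq-injective (allFin m) τ
      (λ p → trans (seq-allFin p) (sym (noDescent⇒identity (counted⇒injective τ c) (seq-bounded τ) ¬d p))))

    extendIf-shrink : ∀ x d → extendIf (proj₁ (shrink x)) (proj₂ (shrink x)) d ≡ x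
    extendIf-shrink (inj₂ tt) (yes d) = ⊥-elim (identity-noDescent m d)
    extendIf-shrink (inj₂ tt) (no _)  = refl
    extendIf-shrink (inj₁ ((σ , c) , e)) (yes _) = ends-≡ (trans (cong (appendLast (dropLast σ)) lastEntry≡top)
                                                                  (appendLast-dropLast σ inj))
      where
      inj = counted⇒injective σ c
      lastEntry≡top : top ≡ lastEntry σ
      lastEntry≡top = toℕ-injective (trans (toℕ-fromℕ m) (sym (trans (toℕ-lastEntry σ)
                        (proj₁ (T-endsInMaxWithDescent σ .to e)))))
      ends-≡ : ∀ {σ′} {c′ e′} → σ′ ≡ σ →
               _≡_ {A = EndsInMaxWithDescent m ⊎ ⊤} (inj₁ ((σ′ , c′) , e′)) (inj₁ ((σ , c) , e))
      ends-≡ {c′ = c′} {e′} refl =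
        cong₂ (λ a b → inj₁ ((σ , a) , b)) (T-irrelevant c′ c) (T-irrelevant e′ e)
    extendIf-shrink (inj₁ ((σ , c) , e)) (no ¬d) = ⊥-elim (¬d (hasDescent-append⁻ (dropLast-appends σ inj)
      (seq-bounded (dropLast σ)) (≤-reflexive (sym lastMax)) descent))
      where
      inj = counted⇒injective σ c
      lastMax = proj₁ (T-endsInMaxWithDescent σ .to e)
      descent = proj₂ (T-endsInMaxWithDescent σ .to e)

  endsInMax⊎⊤↔ : (EndsInMaxWithDescent m ⊎ ⊤) ↔ Counted m
  endsInMax⊎⊤↔ = mk↔ₛ′ shrink (λ (τ , c) → extendIf τ c (hasDescent? (seq τ) m))
    (λ (τ , c) → shrink-extendIf τ c (hasDescent? (seq τ) m))
    (λ x → extendIf-shrink x (hasDescent? (seq (proj₁ (shrink x))) m))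

count : ℕ → ℕ
count 0             = 1
count 1             = 1
count (suc (suc m)) = count (suc m) * 2 + pred (count m)

unique↔ : ∀ n → (∀ (π : Word n) → π ≡ allFin n) → Counted n ↔ Fin 1
unique↔ n unique = mk↔ₛ′ (λ _ → fzero) (λ _ → allFin n , identity-counted n)
  (λ { fzero → refl ; (fsuc ()) }) (λ (π , c) → Σ-T-≡ {P = isCounted} (sym (unique π)))

counted↔ : ∀ n → Counted n ↔ Fin (count n)
counted↔ 0             = unique↔ 0 λ { [] → refl }
counted↔ 1             = unique↔ 1 λ { (fzero ∷ []) → refl }
counted↔ (suc (suc m)) =
  ↔-trans (counted-suc↔ (suc m))
  (↔-trans (Σ-↔ ↔-refl (λ {(σ , c)} → appendings↔ σ c))
  (↔-trans Σ-distribˡ-⊎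
  (↔-trans (↔-trans (counted↔ (suc m) ×-↔ ↔-refl) (↔-sym *↔×)
            ⊎-↔ cancel-⊤ (↔-trans (endsInMax⊎⊤↔ m) (counted↔ m)))
  (↔-sym +↔⊎))))

pell-step : ∀ {c₂ c₁ a b c} → 2 * c₂ ≡ a + b + 1 → 2 * c₁ ≡ b + c + 1 →
            2 * (c₂ * 2 + pred c₁) ≡ (2 * a + b) + (2 * b + c) + 1
pell-step {c₁ = zero}  {b = b} {c} _  H₂ = ⊥-elim (m+1+n≢0 (b + c) (sym H₂))
pell-step {c₂} {suc k} {a} {b} {c} H₁ H₂ = +-cancelʳ-≡ 2 _ _ (begin
  2 * (c₂ * 2 + k) + 2             ≡⟨ expand c₂ k ⟩
  (2 * c₂) * 2 + 2 * suc k         ≡⟨ cong₂ (λ x y → x * 2 + y) H₁ H₂ ⟩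
  (a + b + 1) * 2 + (b + c + 1)    ≡⟨ regroup a b c ⟩
  (2 * a + b) + (2 * b + c) + 1 + 2 ∎)
  where
  open ≡-Reasoning
  expand : ∀ x y → 2 * (x * 2 + y) + 2 ≡ (2 * x) * 2 + 2 * suc y
  expand = solve-∀
  regroup : ∀ a b c → (a + b + 1) * 2 + (b + c + 1) ≡ (2 * a + b) + (2 * b + c) + 1 + 2
  regroup = solve-∀

count-pell : ∀ n → 2 * count (suc n) ≡ Pell (suc n) + Pell n + 1
count-pell 0             = refl
count-pell 1             = refl
count-pell (suc (suc n)) =
  pell-step {count (suc (suc n))} {count (suc n)} {Pell (suc (suc n))} {Pell (suc n)} {Pell n}
            (count-pell (suc n)) (count-pell n)

theorem4p6 : (n : ℕ) → 1 ≤ n →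
    ∃ λ (m : ℕ) → (Σ (Word n) (λ π → T (isCounted π)) ↔ Fin m) ×
      (2 * m ≡ Pell n + Pell (n ∸ 1) + 1)
theorem4p6 (suc n) _ = count (suc n) , counted↔ (suc n) , count-pell n
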